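{- For every positive integer $m$, let $\mathrm{O1}(m)$ denote the number of partitions of $m$ in which no odd part is repeated and the largest part is even, and let $\mathrm{pod}(m)$ denote the number of partitions of $m$ in which no odd part is repeated. Then for all integers $n>1$, \[ \mathrm{O1}(n)+\mathrm{O1}(n-1)=\mathrm{pod}(n). \]
   Context: A partition of $m$ is a finite non-increasing sequence of positive integers $\lambda_1\ge \lambda_2\ge\cdots\ge\lambda_k$ with sum $m$; its parts are the $\lambda_i$ and its largest part is $\lambda_1$. "No odd part is repeated" means every odd integer occurs at most once among the parts (even parts may repeat). -}

module Defs where

open import Data.Nat using (ℕ; zero; suc; _+_; _∸_; _≤_; _<_; _⊓_)
open import Data.Nat.Divisibility using (_∣_; _∣?_)
open import Data.List using (List; []; _∷_; map; filter; length; concatMap; sum; upTo)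
open import Data.List.Relation.Unary.All using (All; all?)
open import Relation.Nullary using (¬_)
open import Relation.Nullary.Decidable using (Dec; yes; no; ¬?; _×-dec_; _→-dec_)
open import Relation.Unary using (Decidable)
open import Data.Product using (_×_)
open import Relation.Binary.PropositionalEquality using (_≡_)

-- Partitions are represented as non-increasing lists of positive parts,
-- λ₁ ≥ λ₂ ≥ ⋯ ≥ λ_k, as in the paper.

-- boundedPartitions fuel k m : all non-increasing lists of positive
-- integers, each ≤ k, summing to m.  The fuel bounds the number of parts;
-- fuel = m suffices since every part is ≥ 1.
boundedPartitions : ℕ → ℕ → ℕ → List (List ℕ)
boundedPartitions fuel       k zero    = [] ∷ []
boundedPartitions zero       k (suc m) = []
boundedPartitions (suc fuel) k (suc m) =
  -- choose the first (largest) part p = suc j with 1 ≤ p ≤ min k (suc m),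
  -- then the rest is a partition of (suc m ∸ p) with parts ≤ p
  concatMap (λ j → map (λ rest → suc j ∷ rest)
                       (boundedPartitions fuel (suc j) (suc m ∸ suc j)))
            (upTo (k ⊓ suc m))

partitions : ℕ → List (List ℕ)
partitions m = boundedPartitions m m m

Odd : ℕ → Set
Odd n = ¬ (2 ∣ n)

occurrences : ℕ → List ℕ → ℕ
occurrences n [] = 0
occurrences n (x ∷ xs) with n Data.Nat.≟ x
... | yes _ = suc (occurrences n xs)
... | no  _ = occurrences n xs

NoOddPartRepeated : List ℕ → Set
NoOddPartRepeated λs = All (λ p → Odd p → occurrences p λs ≤ 1) λs

noOddPartRepeated? : Decidable NoOddPartRepeated
noOddPartRepeated? λs =
  all? (λ p → ¬? (2 ∣? p) →-dec (occurrences p λs Data.Nat.≤? 1)) λs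

data LargestPartEven : List ℕ → Set where
  largest-even : ∀ {p ps} → 2 ∣ p → LargestPartEven (p ∷ ps)

largestPartEven? : Decidable LargestPartEven
largestPartEven? [] = no (λ ())
largestPartEven? (p ∷ ps) with 2 ∣? p
... | yes e = yes (largest-even e)
... | no ¬e = no (λ { (largest-even e) → ¬e e })

pod : ℕ → ℕ
pod m = length (filter noOddPartRepeated? (partitions m))

O1 : ℕ → ℕ
O1 m = length (filter (λ λs → noOddPartRepeated? λs ×-dec largestPartEven? λs)
                      (partitions m))

-- Classify partitions by their largest part p.  Those with p even are exactly the
-- ones counted by O1.  If p = k + 1 is odd it occurs only once, so every other part
-- is at most k, and lowering the largest part to the even number k is a bijection
-- onto the partitions of n − 1 with no repeated odd part and largest part k: the
-- condition on the remaining parts is unaffected, since neither k nor k + 1 is an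
-- odd part occurring among them.  Summing over p gives pod(n) = O1(n) + O1(n − 1).
module Submission where

open import Defs
open import Data.Nat using (ℕ; zero; suc; _+_; _∸_; _≤_; _<_; s≤s; _⊓_; _≟_; _≤?_)
open import Relation.Binary.PropositionalEquality using (_≡_; refl; sym; trans; cong; cong₂; subst; _≢_; _≗_; module ≡-Reasoning)

open import Data.List using (List; []; _∷_; _++_; map; filter; length; concatMap; upTo; applyUpTo; [_])
open import Data.List.Properties using (length-++; filter-++; filter-none; map-++; map-upTo; concatMap-++; concatMap-cong; ++-identityʳ; upTo-∷ʳ)
open import Data.List.Relation.Unary.All as All using (All; []; _∷_)
open import Data.List.Relation.Unary.All.Properties using (map⁺; concat⁺; applyUpTo⁺₁)
open import Data.Nat.Divisibility using (_∣_; _∣0; ∣1⇒≡1; ∣m+n∣m⇒∣n; ∣m∣n⇒∣m+n; ∣-refl)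
open import Data.Nat.ListAction using (sum)
open import Data.Nat.Properties
open import Algebra.Properties.CommutativeSemigroup +-commutativeSemigroup using (interchange)
open import Data.Product using (_×_; _,_; proj₁; ∃-syntax)
open import Data.Sum using (_⊎_; inj₁; inj₂; [_,_]′)
open import Function using (_∘_; _⇔_; mk⇔; Equivalence)
open import Function.Properties.Equivalence as ⇔ using ()
open import Level using (Level)
open import Relation.Nullary using (¬_; yes; no; contradiction)
open import Relation.Nullary.Decidable using (_×-dec_)
open import Relation.Unary using (Pred; Decidable; ∁)

private
  variable
    a ℓ ℓ′ : Level
    A B : Set a

open ≡-Reasoning

count : {P : Pred A ℓ} → Decidable P → List A → ℕ
count P? xs = length (filter P? xs)

module _ {P : Pred A ℓ} (P? : Decidable P) where

  count-++ : ∀ xs ys → count P? (xs ++ ys) ≡ count P? xs + count P? ys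
  count-++ xs ys = trans (cong length (filter-++ P? xs ys)) (length-++ (filter P? xs))

  count-concatMap : ∀ (h : B → List A) xs → count P? (concatMap h xs) ≡ sum (map (count P? ∘ h) xs)
  count-concatMap h []       = refl
  count-concatMap h (x ∷ xs) = trans (count-++ (h x) (concatMap h xs)) (cong (count P? (h x) +_) (count-concatMap h xs))

  count-none : ∀ {xs} → All (∁ P) xs → count P? xs ≡ 0
  count-none ¬Ps = cong length (filter-none P? ¬Ps)

  count-map-cong : {Q : Pred A ℓ′} (Q? : Decidable Q) {f g : B → A} {xs : List B} →
                   All (λ x → P (f x) ⇔ Q (g x)) xs → count P? (map f xs) ≡ count Q? (map g xs)
  count-map-cong Q? []                         = refl
  count-map-cong Q? {f} {g} {x ∷ xs} (eq ∷ eqs) with P? (f x) | Q? (g x)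
  ... | yes _  | yes _  = cong suc (count-map-cong Q? eqs)
  ... | no _   | no _   = count-map-cong Q? eqs
  ... | yes px | no ¬qx = contradiction (Equivalence.to eq px) ¬qx
  ... | no ¬px | yes qx = contradiction (Equivalence.from eq qx) ¬px

applyUpTo-cong : ∀ {f g : ℕ → A} → f ≗ g → ∀ n → applyUpTo f n ≡ applyUpTo g n
applyUpTo-cong f≗g zero    = refl
applyUpTo-cong f≗g (suc n) = cong₂ _∷_ (f≗g 0) (applyUpTo-cong (f≗g ∘ suc) n)

sum-applyUpTo-+ : ∀ (f g : ℕ → ℕ) n →
                  sum (applyUpTo (λ i → f i + g i) n) ≡ sum (applyUpTo f n) + sum (applyUpTo g n)
sum-applyUpTo-+ f g zero    = refl
sum-applyUpTo-+ f g (suc n) = begin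
  f 0 + g 0 + sum (applyUpTo (λ i → f (suc i) + g (suc i)) n)
    ≡⟨ cong (f 0 + g 0 +_) (sum-applyUpTo-+ (f ∘ suc) (g ∘ suc) n) ⟩
  f 0 + g 0 + (sum (applyUpTo (f ∘ suc) n) + sum (applyUpTo (g ∘ suc) n))
    ≡⟨ interchange (f 0) (g 0) _ _ ⟩
  f 0 + sum (applyUpTo (f ∘ suc) n) + (g 0 + sum (applyUpTo (g ∘ suc) n)) ∎

even⇒odd-suc : ∀ {n} → 2 ∣ n → Odd (suc n)
even⇒odd-suc {n} 2∣n 2∣1+n with ∣1⇒≡1 (∣m+n∣m⇒∣n (subst (2 ∣_) (+-comm 1 n) 2∣1+n) 2∣n)
... | ()

even⊎even-suc : ∀ n → 2 ∣ n ⊎ 2 ∣ suc n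
even⊎even-suc zero    = inj₁ (2 ∣0)
even⊎even-suc (suc n) with even⊎even-suc n
... | inj₁ 2∣n   = inj₂ (∣m∣n⇒∣m+n ∣-refl 2∣n)
... | inj₂ 2∣1+n = inj₁ 2∣1+n

occurrences-∷-≡ : ∀ p xs → occurrences p (p ∷ xs) ≡ suc (occurrences p xs)
occurrences-∷-≡ p xs with p ≟ p
... | yes _   = refl
... | no p≢p = contradiction refl p≢p

occurrences-∷-≢ : ∀ {q p} xs → q ≢ p → occurrences q (p ∷ xs) ≡ occurrences q xs
occurrences-∷-≢ {q} {p} xs q≢p with q ≟ p
... | yes q≡p = contradiction q≡p q≢p
... | no _    = refl

occurrences-≤-∷ : ∀ q p xs → occurrences q xs ≤ occurrences q (p ∷ xs)
occurrences-≤-∷ q p xs with q ≟ p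
... | yes _ = n≤1+n _
... | no _  = ≤-refl

occurrences-≡0 : ∀ {p xs} → All (_≢ p) xs → occurrences p xs ≡ 0
occurrences-≡0 []                      = refl
occurrences-≡0 {xs = x ∷ xs} (x≢p ∷ ≢p) =
  trans (occurrences-∷-≢ xs (x≢p ∘ sym)) (occurrences-≡0 ≢p)

noOddPartRepeated-∷⁻ : ∀ {p xs} → NoOddPartRepeated (p ∷ xs) → NoOddPartRepeated xs
noOddPartRepeated-∷⁻ {p} {xs} (_ ∷ ok) =
  All.map (λ {q} h odd → ≤-trans (occurrences-≤-∷ q p xs) (h odd)) ok

noOddPartRepeated-∷⁺ : ∀ {p xs} → All (λ q → Odd q → q ≢ p) xs →
                       NoOddPartRepeated xs → NoOddPartRepeated (p ∷ xs)
noOddPartRepeated-∷⁺ {p} {xs} ≢p ok = head ∷ All.zipWith tail (≢p , ok)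
  where
  head : Odd p → occurrences p (p ∷ xs) ≤ 1
  head odd = ≤-reflexive (trans (occurrences-∷-≡ p xs)
    (cong suc (occurrences-≡0 (All.map (λ {q} h q≡p → h (subst Odd (sym q≡p) odd) q≡p) ≢p))))
  tail : ∀ {q} → (Odd q → q ≢ p) × (Odd q → occurrences q xs ≤ 1) → Odd q → occurrences q (p ∷ xs) ≤ 1
  tail (q≢p , q-once) odd = subst (_≤ 1) (sym (occurrences-∷-≢ xs (q≢p odd))) (q-once odd)

noOddPartRepeated-∷-even : ∀ {p xs} → 2 ∣ p → NoOddPartRepeated (p ∷ xs) ⇔ NoOddPartRepeated xs
noOddPartRepeated-∷-even {p} {xs} 2∣p = mk⇔ noOddPartRepeated-∷⁻ (noOddPartRepeated-∷⁺ odd≢p)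
  where
  odd≢p : All (λ q → Odd q → q ≢ p) xs
  odd≢p = All.universal (λ q odd q≡p → odd (subst (2 ∣_) (sym q≡p) 2∣p)) xs

noOddPartRepeated-∷-< : ∀ {p xs} → All (_< p) xs → NoOddPartRepeated (p ∷ xs) ⇔ NoOddPartRepeated xs
noOddPartRepeated-∷-< <p = mk⇔ noOddPartRepeated-∷⁻ (noOddPartRepeated-∷⁺ (All.map (λ q<p _ → <⇒≢ q<p) <p))

¬noOddPartRepeated-odd-twice : ∀ {p xs} → Odd p → ¬ NoOddPartRepeated (p ∷ p ∷ xs)
¬noOddPartRepeated-odd-twice {p} {xs} odd (p-once ∷ _) =
  contradiction (subst (_≤ 1) twice (p-once odd)) λ { (s≤s ()) }
  where
  twice : occurrences p (p ∷ p ∷ xs) ≡ 2 + occurrences p xs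
  twice = trans (occurrences-∷-≡ p (p ∷ xs)) (cong suc (occurrences-∷-≡ p xs))

-- The partitions of p + r with largest part p, provided the fuel f is at least r.
withLargestPart : ℕ → ℕ → ℕ → List (List ℕ)
withLargestPart f p r = map (p ∷_) (boundedPartitions f p r)

boundedPartitions-bounded : ∀ f k r → All (All (_≤ k)) (boundedPartitions f k r)
boundedPartitions-bounded f       k zero    = [] ∷ []
boundedPartitions-bounded zero    k (suc r) = []
boundedPartitions-bounded (suc f) k (suc r) = concat⁺ (map⁺ (applyUpTo⁺₁ _ (k ⊓ suc r) layer))
  where
  layer : ∀ {j} → j < k ⊓ suc r → All (All (_≤ k)) (withLargestPart f (suc j) (r ∸ j))
  layer {j} j<k⊓1+r = map⁺ (All.map (λ ≤1+j → 1+j≤k ∷ All.map (λ x≤1+j → ≤-trans x≤1+j 1+j≤k) ≤1+j)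
                                    (boundedPartitions-bounded f (suc j) (r ∸ j)))
    where
    1+j≤k : suc j ≤ k
    1+j≤k = ≤-trans j<k⊓1+r (m⊓n≤m k (suc r))

boundedPartitions-fuel : ∀ {f r} k → r ≤ f → boundedPartitions (suc f) k r ≡ boundedPartitions f k r
boundedPartitions-fuel {r = zero}      k _         = refl
boundedPartitions-fuel {suc f} {suc r} k (s≤s r≤f) = concatMap-cong
  (λ j → cong (map (suc j ∷_)) (boundedPartitions-fuel (suc j) (≤-trans (m∸n≤m r j) r≤f)))
  (upTo (k ⊓ suc r))

boundedPartitions-suc : ∀ f k r → ∃[ E ] boundedPartitions f (suc k) r ≡ boundedPartitions f k r ++ map (suc k ∷_) E
boundedPartitions-suc f       k zero    = [] , refl
boundedPartitions-suc zero    k (suc r) = [] , refl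
boundedPartitions-suc (suc f) k (suc r) = [ fits , exceeds ]′ (≤-<-connex k r)
  where
  layer : ℕ → List (List ℕ)
  layer j = withLargestPart f (suc j) (r ∸ j)
  fits : k ≤ r → ∃[ E ] concatMap layer (upTo (suc (k ⊓ r))) ≡ concatMap layer (upTo (k ⊓ suc r)) ++ map (suc k ∷_) E
  fits k≤r = boundedPartitions f (suc k) (r ∸ k) , (begin
    concatMap layer (upTo (suc (k ⊓ r)))      ≡⟨ cong (concatMap layer ∘ upTo ∘ suc) (m≤n⇒m⊓n≡m k≤r) ⟩
    concatMap layer (upTo (suc k))            ≡⟨ cong (concatMap layer) (upTo-∷ʳ k) ⟨
    concatMap layer (upTo k ++ [ k ])         ≡⟨ concatMap-++ layer (upTo k) [ k ] ⟩
    concatMap layer (upTo k) ++ (layer k ++ []) ≡⟨ cong (concatMap layer (upTo k) ++_) (++-identityʳ (layer k)) ⟩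
    concatMap layer (upTo k) ++ layer k       ≡⟨ cong (λ i → concatMap layer (upTo i) ++ layer k) (m≤n⇒m⊓n≡m (m≤n⇒m≤1+n k≤r)) ⟨
    concatMap layer (upTo (k ⊓ suc r)) ++ layer k ∎)
  exceeds : r < k → ∃[ E ] concatMap layer (upTo (suc (k ⊓ r))) ≡ concatMap layer (upTo (k ⊓ suc r)) ++ map (suc k ∷_) E
  exceeds r<k = [] , (begin
    concatMap layer (upTo (suc (k ⊓ r)))      ≡⟨ cong (concatMap layer ∘ upTo ∘ suc) (m≥n⇒m⊓n≡n (<⇒≤ r<k)) ⟩
    concatMap layer (upTo (suc r))            ≡⟨ cong (concatMap layer ∘ upTo) (m≥n⇒m⊓n≡n r<k) ⟨
    concatMap layer (upTo (k ⊓ suc r))        ≡⟨ ++-identityʳ _ ⟨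
    concatMap layer (upTo (k ⊓ suc r)) ++ [] ∎)

count-partitions : ∀ {Q : Pred (List ℕ) ℓ} (Q? : Decidable Q) n →
  count Q? (partitions (suc n)) ≡ sum (applyUpTo (λ j → count Q? (withLargestPart (suc n) (suc j) (n ∸ j))) (suc n))
count-partitions Q? n = begin
  count Q? (partitions (suc n))
    ≡⟨ cong (λ i → count Q? (concatMap layer (upTo (suc i)))) (⊓-idem n) ⟩
  count Q? (concatMap layer (upTo (suc n)))
    ≡⟨ cong (count Q?) (concatMap-cong (λ j → cong (map (suc j ∷_)) (boundedPartitions-fuel (suc j) (m∸n≤m n j))) (upTo (suc n))) ⟨
  count Q? (concatMap (λ j → withLargestPart (suc n) (suc j) (n ∸ j)) (upTo (suc n)))
    ≡⟨ count-concatMap Q? (λ j → withLargestPart (suc n) (suc j) (n ∸ j)) (upTo (suc n)) ⟩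
  sum (map (λ j → count Q? (withLargestPart (suc n) (suc j) (n ∸ j))) (upTo (suc n)))
    ≡⟨ cong sum (map-upTo _ (suc n)) ⟩
  sum (applyUpTo (λ j → count Q? (withLargestPart (suc n) (suc j) (n ∸ j))) (suc n)) ∎
  where
  layer : ℕ → List (List ℕ)
  layer j = withLargestPart n (suc j) (n ∸ j)

NoOddRepeatedEvenLargest : List ℕ → Set
NoOddRepeatedEvenLargest λs = NoOddPartRepeated λs × LargestPartEven λs

noOddRepeatedEvenLargest? : Decidable NoOddRepeatedEvenLargest
noOddRepeatedEvenLargest? λs = noOddPartRepeated? λs ×-dec largestPartEven? λs

count-noOddRepeatedEvenLargest-evenHead : ∀ {p} xs → 2 ∣ p →
  count noOddRepeatedEvenLargest? (map (p ∷_) xs) ≡ count noOddPartRepeated? (map (p ∷_) xs)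
count-noOddRepeatedEvenLargest-evenHead xs 2∣p = count-map-cong noOddRepeatedEvenLargest? noOddPartRepeated?
  (All.universal (λ _ → mk⇔ proj₁ (_, largest-even 2∣p)) xs)

count-noOddRepeatedEvenLargest-oddHead : ∀ {p} xs → Odd p → count noOddRepeatedEvenLargest? (map (p ∷_) xs) ≡ 0
count-noOddRepeatedEvenLargest-oddHead xs odd = count-none noOddRepeatedEvenLargest?
  (map⁺ (All.universal (λ { _ (_ , largest-even 2∣p) → odd 2∣p }) xs))

count-noOddPartRepeated-suc-largest : ∀ f {k} r → 2 ∣ k →
  count noOddPartRepeated? (withLargestPart f (suc k) r) ≡ count noOddPartRepeated? (withLargestPart f k r)
count-noOddPartRepeated-suc-largest f {k} r 2∣k with boundedPartitions-suc f k r
... | E , split = begin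
  count P? (map (suc k ∷_) (boundedPartitions f (suc k) r))
    ≡⟨ cong (count P? ∘ map (suc k ∷_)) split ⟩
  count P? (map (suc k ∷_) (bounded ++ map (suc k ∷_) E))
    ≡⟨ cong (count P?) (map-++ (suc k ∷_) bounded (map (suc k ∷_) E)) ⟩
  count P? (map (suc k ∷_) bounded ++ map (suc k ∷_) (map (suc k ∷_) E))
    ≡⟨ count-++ P? (map (suc k ∷_) bounded) _ ⟩
  count P? (map (suc k ∷_) bounded) + count P? (map (suc k ∷_) (map (suc k ∷_) E))
    ≡⟨ cong₂ _+_ (count-map-cong P? P? (All.map lower (boundedPartitions-bounded f k r)))
                 (count-none P? (map⁺ (map⁺ (All.universal (λ _ → ¬noOddPartRepeated-odd-twice (even⇒odd-suc 2∣k)) E)))) ⟩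
  count P? (map (k ∷_) bounded) + 0
    ≡⟨ +-identityʳ _ ⟩
  count P? (map (k ∷_) bounded) ∎
  where
  P? : Decidable NoOddPartRepeated
  P? = noOddPartRepeated?
  bounded : List (List ℕ)
  bounded = boundedPartitions f k r
  lower : ∀ {xs} → All (_≤ k) xs → NoOddPartRepeated (suc k ∷ xs) ⇔ NoOddPartRepeated (k ∷ xs)
  lower ≤k = ⇔.trans (noOddPartRepeated-∷-< (All.map s≤s ≤k)) (⇔.sym (noOddPartRepeated-∷-even 2∣k))

count-withLargestPart-suc : ∀ n p →
  count noOddPartRepeated? (withLargestPart (suc n) (suc p) (n ∸ p)) ≡
  count noOddRepeatedEvenLargest? (withLargestPart (suc n) (suc p) (n ∸ p)) +
  count noOddRepeatedEvenLargest? (withLargestPart n p (n ∸ p))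
count-withLargestPart-suc n p = [ oddLargest , evenLargest ]′ (even⊎even-suc p)
  where
  P? : Decidable NoOddPartRepeated
  P? = noOddPartRepeated?
  O1? : Decidable NoOddRepeatedEvenLargest
  O1? = noOddRepeatedEvenLargest?
  upper lower : List (List ℕ)
  upper = withLargestPart (suc n) (suc p) (n ∸ p)
  lower = withLargestPart n p (n ∸ p)
  oddLargest : 2 ∣ p → count P? upper ≡ count O1? upper + count O1? lower
  oddLargest 2∣p = begin
    count P? upper
      ≡⟨ cong (count P? ∘ map (suc p ∷_)) (boundedPartitions-fuel (suc p) (m∸n≤m n p)) ⟩
    count P? (withLargestPart n (suc p) (n ∸ p))
      ≡⟨ count-noOddPartRepeated-suc-largest n (n ∸ p) 2∣p ⟩
    count P? lower
      ≡⟨ count-noOddRepeatedEvenLargest-evenHead (boundedPartitions n p (n ∸ p)) 2∣p ⟨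
    count O1? lower
      ≡⟨ cong (_+ count O1? lower) (count-noOddRepeatedEvenLargest-oddHead (boundedPartitions (suc n) (suc p) (n ∸ p)) (even⇒odd-suc 2∣p)) ⟨
    count O1? upper + count O1? lower ∎
  evenLargest : 2 ∣ suc p → count P? upper ≡ count O1? upper + count O1? lower
  evenLargest 2∣1+p = begin
    count P? upper
      ≡⟨ count-noOddRepeatedEvenLargest-evenHead (boundedPartitions (suc n) (suc p) (n ∸ p)) 2∣1+p ⟨
    count O1? upper
      ≡⟨ +-identityʳ _ ⟨
    count O1? upper + 0
      ≡⟨ cong (count O1? upper +_) (count-noOddRepeatedEvenLargest-oddHead (boundedPartitions n p (n ∸ p)) (λ 2∣p → even⇒odd-suc 2∣p 2∣1+p)) ⟨
    count O1? upper + count O1? lower ∎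

theorem1p4 : (n : ℕ) → 1 < n → O1 n + O1 (n ∸ 1) ≡ pod n
theorem1p4 (suc zero)    (s≤s ())
theorem1p4 (suc (suc m)) _ = sym (begin
  pod (2 + m)
    ≡⟨ count-partitions noOddPartRepeated? (suc m) ⟩
  sum (applyUpTo (λ j → count noOddPartRepeated? (withLargestPart (2 + m) (suc j) (suc m ∸ j))) (2 + m))
    ≡⟨ cong sum (applyUpTo-cong (count-withLargestPart-suc (suc m)) (2 + m)) ⟩
  sum (applyUpTo (λ j → o1WithLargest (2 + m) (suc j) + o1WithLargest (suc m) j) (2 + m))
    ≡⟨ sum-applyUpTo-+ (o1WithLargest (2 + m) ∘ suc) (o1WithLargest (suc m)) (2 + m) ⟩
  sum (applyUpTo (o1WithLargest (2 + m) ∘ suc) (2 + m)) + sum (applyUpTo (o1WithLargest (suc m)) (2 + m))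
    -- no partition of m + 1 > 0 has largest part 0: this is where 1 < n is used
    ≡⟨⟩
  sum (applyUpTo (o1WithLargest (2 + m) ∘ suc) (2 + m)) + (0 + sum (applyUpTo (o1WithLargest (suc m) ∘ suc) (suc m)))
    ≡⟨ cong₂ _+_ (count-partitions noOddRepeatedEvenLargest? (suc m)) (count-partitions noOddRepeatedEvenLargest? m) ⟨
  O1 (2 + m) + O1 (suc m) ∎)
  where
  o1WithLargest : ℕ → ℕ → ℕ
  o1WithLargest n p = count noOddRepeatedEvenLargest? (withLargestPart n p (n ∸ p))
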